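{- Let $G$ be a connected nonsingular graph on $6$ vertices with girth $5$. Then $G$ is isomorphic to the graph obtained from the $5$-cycle $C_5$ by attaching one pendant vertex to one of its vertices.
   Context: All graphs are finite and simple. A graph is nonsingular if its adjacency matrix is invertible. The girth is the length of a shortest cycle. -}

module Defs where

open import Data.Nat using (ℕ; zero; suc; _≤_; _<_)
open import Data.Fin using (Fin; zero; suc; punchIn; fromℕ; inject₁; toℕ)
open import Data.Integer as ℤ using (ℤ; 0ℤ; 1ℤ)
open import Data.Bool using (Bool; true; false; if_then_else_; T; _∨_)
open import Data.Bool.Properties using (∨-comm)
open import Data.Empty using (⊥)
open import Relation.Nullary using (¬_)
open import Data.Product using (Σ; ∃; _×_; _,_)
open import Relation.Binary.PropositionalEquality using (_≡_; _≢_; refl)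
open import Function.Definitions using (Injective)
open import Function.Bundles using (_↔_; Inverse)

record Graph (n : ℕ) : Set where
  field
    adj    : Fin n → Fin n → Bool
    sym    : ∀ u v → adj u v ≡ adj v u
    irrefl : ∀ v → adj v v ≡ false
open Graph public

Adj : ∀ {n} → Graph n → Fin n → Fin n → Set
Adj G u v = T (adj G u v)

data Reach {n : ℕ} (G : Graph n) : Fin n → Fin n → Set where
  here : ∀ {v} → Reach G v v
  step : ∀ {u w v} → Adj G u w → Reach G w v → Reach G u v

Connected : ∀ {n} → Graph n → Set
Connected G = ∀ u v → Reach G u v

sumFin : ∀ {n} → (Fin n → ℤ) → ℤ
sumFin {zero}  f = 0ℤ
sumFin {suc n} f = f zero ℤ.+ sumFin (λ i → f (suc i))

sign : ℕ → ℤ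
sign zero = 1ℤ
sign (suc k) = ℤ.- sign k

det : ∀ {n} → (Fin n → Fin n → ℤ) → ℤ
det {zero}  M = 1ℤ
det {suc n} M =
  sumFin (λ j → sign (toℕ j) ℤ.* (M zero j ℤ.* det (λ r c → M (suc r) (punchIn j c))))

adjMatrix : ∀ {n} → Graph n → Fin n → Fin n → ℤ
adjMatrix G u v = if adj G u v then 1ℤ else 0ℤ

-- Nonsingular: the adjacency matrix is invertible (over ℚ or ℝ),
-- i.e. its determinant is nonzero.
Nonsingular : ∀ {n} → Graph n → Set
Nonsingular G = det (adjMatrix G) ≢ 0ℤ

record Cycle3+ {n : ℕ} (G : Graph n) (m : ℕ) : Set where
  field
    vert    : Fin (suc (suc (suc m))) → Fin n
    inj     : Injective _≡_ _≡_ vert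
    consec  : ∀ (i : Fin (suc (suc m))) → Adj G (vert (inject₁ i)) (vert (suc i))
    closing : Adj G (vert (fromℕ (suc (suc m)))) (vert zero)

-- G contains a cycle of length k (cycles in a simple graph have length ≥ 3).
HasCycleOfLength : ∀ {n} → Graph n → ℕ → Set
HasCycleOfLength G (suc (suc (suc m))) = Cycle3+ G m
HasCycleOfLength G _ = ⊥

Girth≡ : ∀ {n} → Graph n → ℕ → Set
Girth≡ G g = HasCycleOfLength G g × (∀ k → k < g → ¬ HasCycleOfLength G k)

_≅_ : ∀ {n} → Graph n → Graph n → Set
_≅_ {n} G H = Σ (Fin n ↔ Fin n) λ f →
  ∀ u v → adj G u v ≡ adj H (Inverse.to f u) (Inverse.to f v)

c5edge : ℕ → ℕ → Bool
c5edge 0 1 = true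
c5edge 1 2 = true
c5edge 2 3 = true
c5edge 3 4 = true
c5edge 4 0 = true
c5edge 0 5 = true
c5edge _ _ = false

c5adj : Fin 6 → Fin 6 → Bool
c5adj u v = c5edge (toℕ u) (toℕ v) ∨ c5edge (toℕ v) (toℕ u)

C5+pendant : Graph 6
C5+pendant = record { adj = c5adj ; sym = s ; irrefl = i }
  where
  s : ∀ u v → c5adj u v ≡ c5adj v u
  s u v = ∨-comm (c5edge (toℕ u) (toℕ v)) (c5edge (toℕ v) (toℕ u))
  i : ∀ v → c5adj v v ≡ false
  i zero = refl
  i (suc zero) = refl
  i (suc (suc zero)) = refl
  i (suc (suc (suc zero))) = refl
  i (suc (suc (suc (suc zero)))) = refl
  i (suc (suc (suc (suc (suc zero))))) = refl

-- A 5-cycle of G leaves one vertex p off it, and connectivity attaches p to some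
-- cycle vertex. Relabelling G so that the cycle is 0-1-2-3-4 and p = 5 hangs on 0,
-- every remaining pair of vertices is joined by a path of length 2 or 3 in these
-- six edges, so an edge between them would close a triangle or a square, which
-- girth 5 forbids.
module Submission where

open import Defs hiding (sym)
open import Data.Bool using (true; false; T)
open import Data.Bool.Properties using (T-≡)
open import Data.Empty using (⊥-elim)
open import Data.Fin using (Fin; toℕ; splitAt; join; _↑ˡ_; punchOut)
open import Data.Fin.Patterns using (0F; 1F; 2F; 3F; 4F; 5F)
open import Data.Fin.Properties
  using (_≟_; any?; all?; ¬∀⟶∃¬; <⇒notInjective; punchOut-injective; join-splitAt; splitAt-↑ˡ)
open import Data.Nat using (ℕ; zero; suc; _<_; _+_; _<?_)
open import Data.Nat.Properties using (n<1+n)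
open import Data.Product using (∃; _,_; proj₁; proj₂; map₂)
open import Data.Sum using (inj₁; inj₂; [_,_]′)
open import Data.Vec using ([]; _∷_; lookup)
open import Function using (_∘_; const)
open import Function.Bundles using (Equivalence; mk↔ₛ′)
open import Function.Definitions using (Injective)
open import Relation.Nullary using (¬_; Dec; yes; no; contradiction)
open import Relation.Nullary.Decidable using (True; map′; toWitness; from-yes; _→-dec_)
open import Relation.Binary.PropositionalEquality
  using (_≡_; _≢_; refl; sym; trans; cong; cong₂; subst; subst₂; module ≡-Reasoning)

private
  variable
    m n : ℕ

injective? : (f : Fin m → Fin n) → Dec (Injective _≡_ _≡_ f)
injective? f = map′ (λ inj {i} {j} → inj i j) (λ inj i j → inj)
  (all? λ i → all? λ j → (f i ≟ f j) →-dec (i ≟ j))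

injective⇒surjective : {f : Fin n → Fin n} → Injective _≡_ _≡_ f → ∀ y → ∃ λ x → f x ≡ y
injective⇒surjective {suc n} {f} f-inj y with any? (λ x → f x ≟ y)
... | yes hit = hit
... | no miss = ⊥-elim (<⇒notInjective (n<1+n n) punchOut-f-injective)
  where
  y≢f : ∀ x → y ≢ f x
  y≢f x e = miss (x , sym e)
  punchOut-f-injective : Injective _≡_ _≡_ (λ x → punchOut (y≢f x))
  punchOut-f-injective e = f-inj (punchOut-injective (y≢f _) (y≢f _) e)

injective⇒∃-non-value : {f : Fin m → Fin n} → Injective _≡_ _≡_ f → m < n → ∃ λ p → ∀ i → f i ≢ p
injective⇒∃-non-value {m} {n} {f} f-inj m<n =
  map₂ (λ not-hit i e → not-hit (i , e))
       (¬∀⟶∃¬ n (λ y → ∃ λ x → f x ≡ y) (λ y → any? λ x → f x ≟ y) not-onto)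
  where
  not-onto : ¬ (∀ y → ∃ λ x → f x ≡ y)
  not-onto onto = <⇒notInjective m<n λ {y} {y′} e →
    trans (sym (proj₂ (onto y))) (trans (cong f e) (proj₂ (onto y′)))

extend : (Fin m → Fin n) → Fin n → Fin (m + 1) → Fin n
extend {m} c p = [ c , const p ]′ ∘ splitAt m

extend-↑ˡ : (c : Fin m → Fin n) (p : Fin n) (i : Fin m) → extend c p (i ↑ˡ 1) ≡ c i
extend-↑ˡ {m} c p i = cong [ c , const p ]′ (splitAt-↑ˡ m i 1)

module _ {c : Fin m → Fin n} {p : Fin n} (c-inj : Injective _≡_ _≡_ c) (p∉c : ∀ i → c i ≢ p) where

  extend-injective : Injective _≡_ _≡_ (extend c p)
  extend-injective {x} {y} e = begin
    x                      ≡⟨ sym (join-splitAt m 1 x) ⟩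
    join m 1 (splitAt m x) ≡⟨ cong (join m 1) (split-injective (splitAt m x) (splitAt m y) e) ⟩
    join m 1 (splitAt m y) ≡⟨ join-splitAt m 1 y ⟩
    y                      ∎
    where
    open ≡-Reasoning
    split-injective : ∀ s t → [ c , const p ]′ s ≡ [ c , const p ]′ t → s ≡ t
    split-injective (inj₁ i) (inj₁ j) e = cong inj₁ (c-inj e)
    split-injective (inj₁ i) (inj₂ _) e = contradiction e (p∉c i)
    split-injective (inj₂ _) (inj₁ j) e = contradiction (sym e) (p∉c j)
    split-injective (inj₂ 0F) (inj₂ 0F) _ = refl

injective⇒∃-preimage : {c : Fin m → Fin (m + 1)} {p : Fin (m + 1)} →
                       Injective _≡_ _≡_ c → (∀ i → c i ≢ p) → ∀ v → v ≢ p → ∃ λ i → c i ≡ v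
injective⇒∃-preimage {m} c-inj p∉c v v≢p with injective⇒surjective (extend-injective c-inj p∉c) v
... | x , e with splitAt m x
...   | inj₁ i = i , e
...   | inj₂ _ = contradiction (sym e) v≢p

module _ {G : Graph n} where

  Adj-sym : ∀ {u v} → Adj G u v → Adj G v u
  Adj-sym {u} {v} = subst T (Graph.sym G u v)

  Adj⇒≢ : ∀ {u v} → Adj G u v → u ≢ v
  Adj⇒≢ {u} uv refl = subst T (irrefl G u) uv

  Reach⇒∃Adj : ∀ {u v} → Reach G u v → u ≢ v → ∃ λ w → Adj G u w
  Reach⇒∃Adj here         u≢u = contradiction refl u≢u
  Reach⇒∃Adj (step uw _)  _   = _ , uw

  -- For concrete vertices the distinctness argument is found by evaluation.
  triangle : ∀ x y z → {True (injective? (lookup (x ∷ y ∷ z ∷ [])))} →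
             Adj G x y → Adj G y z → Adj G z x → Cycle3+ G 0
  triangle x y z {distinct} xy yz zx = record
    { vert    = lookup (x ∷ y ∷ z ∷ [])
    ; inj     = toWitness distinct
    ; consec  = λ { 0F → xy ; 1F → yz }
    ; closing = zx
    }

  square : ∀ x y z w → {True (injective? (lookup (x ∷ y ∷ z ∷ w ∷ [])))} →
           Adj G x y → Adj G y z → Adj G z w → Adj G w x → Cycle3+ G 1
  square x y z w {distinct} xy yz zw wx = record
    { vert    = lookup (x ∷ y ∷ z ∷ w ∷ [])
    ; inj     = toWitness distinct
    ; consec  = λ { 0F → xy ; 1F → yz ; 2F → zw }
    ; closing = wx
    }

relabel : Graph n → (Fin m → Fin n) → Graph m
relabel G σ = record
  { adj    = λ a b → adj G (σ a) (σ b)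
  ; sym    = λ a b → Graph.sym G (σ a) (σ b)
  ; irrefl = λ a → irrefl G (σ a)
  }

module _ {G : Graph n} {σ : Fin m → Fin n} (σ-inj : Injective _≡_ _≡_ σ) where

  Cycle3+-relabel : ∀ {k} → Cycle3+ (relabel G σ) k → Cycle3+ G k
  Cycle3+-relabel C = record
    { vert    = σ ∘ vert
    ; inj     = inj ∘ σ-inj
    ; consec  = consec
    ; closing = closing
    }
    where open Cycle3+ C

relabel⇒≅ : {G H : Graph n} (σ : Fin n → Fin n) → Injective _≡_ _≡_ σ →
            (∀ a b → adj G (σ a) (σ b) ≡ adj H a b) → G ≅ H
relabel⇒≅ {G = G} {H} σ σ-inj σ-relabels = mk↔ₛ′ σ⁻¹ σ σ⁻¹∘σ σ∘σ⁻¹ , λ u v → begin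
  adj G u v                     ≡⟨ cong₂ (adj G) (sym (σ∘σ⁻¹ u)) (sym (σ∘σ⁻¹ v)) ⟩
  adj G (σ (σ⁻¹ u)) (σ (σ⁻¹ v)) ≡⟨ σ-relabels (σ⁻¹ u) (σ⁻¹ v) ⟩
  adj H (σ⁻¹ u) (σ⁻¹ v)         ∎
  where
  open ≡-Reasoning
  σ⁻¹ : Fin _ → Fin _
  σ⁻¹ v = proj₁ (injective⇒surjective σ-inj v)
  σ∘σ⁻¹ : ∀ v → σ (σ⁻¹ v) ≡ v
  σ∘σ⁻¹ v = proj₂ (injective⇒surjective σ-inj v)
  σ⁻¹∘σ : ∀ a → σ⁻¹ (σ a) ≡ a
  σ⁻¹∘σ a = σ-inj (σ∘σ⁻¹ (σ a))

next : Fin 5 → Fin 5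
next 0F = 1F
next 1F = 2F
next 2F = 3F
next 3F = 4F
next 4F = 0F

record Pentagon (G : Graph n) : Set where
  field
    corner    : Fin 5 → Fin n
    injective : Injective _≡_ _≡_ corner
    side      : ∀ i → Adj G (corner i) (corner (next i))

open Pentagon

module _ {G : Graph n} where

  Cycle3+⇒Pentagon : Cycle3+ G 2 → Pentagon G
  Cycle3+⇒Pentagon C = record { corner = vert ; injective = inj ; side = side′ }
    where
    open Cycle3+ C
    side′ : ∀ i → Adj G (vert i) (vert (next i))
    side′ 0F = consec 0F
    side′ 1F = consec 1F
    side′ 2F = consec 2F
    side′ 3F = consec 3F
    side′ 4F = closing

  rotate : Pentagon G → Pentagon G
  rotate P = record
    { corner    = corner P ∘ next
    ; injective = toWitness {a? = injective? next} _ ∘ injective P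
    ; side      = side P ∘ next
    }

  rotate^ : ℕ → Pentagon G → Pentagon G
  rotate^ zero    P = P
  rotate^ (suc k) P = rotate^ k (rotate P)

  rotate^-corner₀ : ∀ P k → corner (rotate^ (toℕ k) P) 0F ≡ corner P k
  rotate^-corner₀ P 0F = refl
  rotate^-corner₀ P 1F = refl
  rotate^-corner₀ P 2F = refl
  rotate^-corner₀ P 3F = refl
  rotate^-corner₀ P 4F = refl

  rotate^-avoids : ∀ k P {p} → (∀ i → corner P i ≢ p) → ∀ i → corner (rotate^ k P) i ≢ p
  rotate^-avoids zero    P p∉P = p∉P
  rotate^-avoids (suc k) P p∉P = rotate^-avoids k (rotate P) (p∉P ∘ next)

¬T⇒≡false : ∀ {b} → ¬ T b → b ≡ false
¬T⇒≡false {false} _  = refl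
¬T⇒≡false {true}  ¬t = contradiction _ ¬t

module _ (K : Graph 6)
         (sides   : ∀ i → Adj K (i ↑ˡ 1) (next i ↑ˡ 1))
         (pendant : Adj K 5F 0F)
         (no-triangle : ¬ Cycle3+ K 0)
         (no-square   : ¬ Cycle3+ K 1)
         where

  _⁻¹ : ∀ {u v} → Adj K u v → Adj K v u
  _⁻¹ = Adj-sym {G = K}

  no-chord₂ : ∀ x y z → {True (injective? (lookup (x ∷ y ∷ z ∷ [])))} →
              Adj K x y → Adj K y z → adj K x z ≡ false
  no-chord₂ x y z {distinct} xy yz =
    ¬T⇒≡false λ xz → no-triangle (triangle x y z {distinct} xy yz (xz ⁻¹))

  no-chord₃ : ∀ x y z w → {True (injective? (lookup (x ∷ y ∷ z ∷ w ∷ [])))} →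
              Adj K x y → Adj K y z → Adj K z w → adj K x w ≡ false
  no-chord₃ x y z w {distinct} xy yz zw =
    ¬T⇒≡false λ xw → no-square (square x y z w {distinct} xy yz zw (xw ⁻¹))

  edge : ∀ {a b} → Adj K a b → adj K a b ≡ true
  edge = Equivalence.to T-≡

  adj≡c5adj : ∀ a b → adj K a b ≡ c5adj a b
  adj≡c5adj 0F 0F = irrefl K 0F
  adj≡c5adj 0F 1F = edge (sides 0F)
  adj≡c5adj 0F 2F = no-chord₂ 0F 1F 2F (sides 0F) (sides 1F)
  adj≡c5adj 0F 3F = no-chord₂ 0F 4F 3F (sides 4F ⁻¹) (sides 3F ⁻¹)
  adj≡c5adj 0F 4F = edge (sides 4F ⁻¹)
  adj≡c5adj 0F 5F = edge (pendant ⁻¹)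
  adj≡c5adj 1F 1F = irrefl K 1F
  adj≡c5adj 1F 2F = edge (sides 1F)
  adj≡c5adj 1F 3F = no-chord₂ 1F 2F 3F (sides 1F) (sides 2F)
  adj≡c5adj 1F 4F = no-chord₂ 1F 0F 4F (sides 0F ⁻¹) (sides 4F ⁻¹)
  adj≡c5adj 1F 5F = no-chord₂ 1F 0F 5F (sides 0F ⁻¹) (pendant ⁻¹)
  adj≡c5adj 2F 2F = irrefl K 2F
  adj≡c5adj 2F 3F = edge (sides 2F)
  adj≡c5adj 2F 4F = no-chord₂ 2F 3F 4F (sides 2F) (sides 3F)
  adj≡c5adj 2F 5F = no-chord₃ 2F 1F 0F 5F (sides 1F ⁻¹) (sides 0F ⁻¹) (pendant ⁻¹)
  adj≡c5adj 3F 3F = irrefl K 3F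
  adj≡c5adj 3F 4F = edge (sides 3F)
  adj≡c5adj 3F 5F = no-chord₃ 3F 4F 0F 5F (sides 3F) (sides 4F) (pendant ⁻¹)
  adj≡c5adj 4F 4F = irrefl K 4F
  adj≡c5adj 4F 5F = no-chord₂ 4F 0F 5F (sides 4F) (pendant ⁻¹)
  adj≡c5adj 5F 5F = irrefl K 5F
  adj≡c5adj 1F 0F = trans (Graph.sym K 1F 0F) (adj≡c5adj 0F 1F)
  adj≡c5adj 2F 0F = trans (Graph.sym K 2F 0F) (adj≡c5adj 0F 2F)
  adj≡c5adj 3F 0F = trans (Graph.sym K 3F 0F) (adj≡c5adj 0F 3F)
  adj≡c5adj 4F 0F = trans (Graph.sym K 4F 0F) (adj≡c5adj 0F 4F)
  adj≡c5adj 5F 0F = trans (Graph.sym K 5F 0F) (adj≡c5adj 0F 5F)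
  adj≡c5adj 2F 1F = trans (Graph.sym K 2F 1F) (adj≡c5adj 1F 2F)
  adj≡c5adj 3F 1F = trans (Graph.sym K 3F 1F) (adj≡c5adj 1F 3F)
  adj≡c5adj 4F 1F = trans (Graph.sym K 4F 1F) (adj≡c5adj 1F 4F)
  adj≡c5adj 5F 1F = trans (Graph.sym K 5F 1F) (adj≡c5adj 1F 5F)
  adj≡c5adj 3F 2F = trans (Graph.sym K 3F 2F) (adj≡c5adj 2F 3F)
  adj≡c5adj 4F 2F = trans (Graph.sym K 4F 2F) (adj≡c5adj 2F 4F)
  adj≡c5adj 5F 2F = trans (Graph.sym K 5F 2F) (adj≡c5adj 2F 5F)
  adj≡c5adj 4F 3F = trans (Graph.sym K 4F 3F) (adj≡c5adj 3F 4F)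
  adj≡c5adj 5F 3F = trans (Graph.sym K 5F 3F) (adj≡c5adj 3F 5F)
  adj≡c5adj 5F 4F = trans (Graph.sym K 5F 4F) (adj≡c5adj 4F 5F)

record PendantPentagon (G : Graph 6) : Set where
  field
    pentagon     : Pentagon G
    pendant      : Fin 6
    off-pentagon : ∀ i → corner pentagon i ≢ pendant
    attached     : Adj G pendant (corner pentagon 0F)

PendantPentagon⇒≅ : {G : Graph 6} → PendantPentagon G →
                    ¬ Cycle3+ G 0 → ¬ Cycle3+ G 1 → G ≅ C5+pendant
PendantPentagon⇒≅ {G} X no-triangle no-square =
  relabel⇒≅ {G = G} {H = C5+pendant} σ σ-inj (adj≡c5adj (relabel G σ) sides attached
    (no-triangle ∘ Cycle3+-relabel σ-inj) (no-square ∘ Cycle3+-relabel σ-inj))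
  where
  open PendantPentagon X
  σ : Fin 6 → Fin 6
  σ = extend (corner pentagon) pendant
  σ-inj : Injective _≡_ _≡_ σ
  σ-inj = extend-injective (injective pentagon) off-pentagon
  sides : ∀ i → Adj (relabel G σ) (i ↑ˡ 1) (next i ↑ˡ 1)
  sides i = subst₂ (Adj G) (sym (extend-↑ˡ _ pendant i)) (sym (extend-↑ˡ _ pendant (next i)))
                   (side pentagon i)

Connected⇒PendantPentagon : {G : Graph 6} → Connected G → Pentagon G → PendantPentagon G
Connected⇒PendantPentagon {G} connected P
  with p , p∉P ← injective⇒∃-non-value (injective P) (n<1+n 5)
  with w , p~w ← Reach⇒∃Adj (connected p (corner P 0F)) (p∉P 0F ∘ sym)
  with k , Pₖ≡w ← injective⇒∃-preimage (injective P) p∉P w (Adj⇒≢ {G = G} p~w ∘ sym)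
  = record
  { pentagon     = rotate^ (toℕ k) P
  ; pendant      = p
  ; off-pentagon = rotate^-avoids (toℕ k) P p∉P
  ; attached     = subst (Adj G p) (sym (trans (rotate^-corner₀ P k) Pₖ≡w)) p~w
  }

lemma3p3 : (G : Graph 6) → Connected G → Nonsingular G → Girth≡ G 5 → G ≅ C5+pendant
lemma3p3 G connected _ (pentagon , no-shorter-cycle) =
  PendantPentagon⇒≅ (Connected⇒PendantPentagon connected (Cycle3+⇒Pentagon pentagon))
    (no-shorter-cycle 3 (from-yes (3 <? 5)))
    (no-shorter-cycle 4 (from-yes (4 <? 5)))
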